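{- Let $\mathbb F_q$ be a finite field of characteristic $p$ and let $S,S'\subseteq\mathbb F_q$ be $\mathbb F_p$-vector subspaces such that $S'=\{as: s\in S\}$ for some $a\in\mathbb F_q^*$. For a positive integer $n$ and an $\mathbb F_p$-subspace $T\subseteq \mathbb F_q$, let $C_T(n)$ be the set of monic irreducible polynomials $f\in\mathbb F_q[x]$ of degree $n$ with $f(x+t)=f(x)$ for all $t\in T$. Then $|C_S(n)|=|C_{S'}(n)|$ for all positive integers $n$. -}

module Defs where

open import Level using (0ℓ)
open import Data.Nat as ℕ using (ℕ; zero; suc)
open import Data.Fin using (Fin)
open import Data.List using (List; []; _∷_; length)
open import Data.List.Relation.Unary.Unique.Propositional using (Unique)
open import Data.List.Membership.Propositional using (_∈_)
open import Data.Vec using (Vec; toList)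
open import Data.Product using (Σ; ∃; _×_; _,_)
open import Data.Sum using (_⊎_)
open import Relation.Binary.PropositionalEquality using (_≡_; _≢_)
open import Relation.Nullary using (¬_)
open import Function.Bundles using (_↔_; _⇔_)
open import Algebra.Structures using (IsCommutativeRing)

record FiniteField : Set₁ where
  infixl 7 _*_
  infixl 6 _+_
  field
    Carrier  : Set
    _+_ _*_  : Carrier → Carrier → Carrier
    -_       : Carrier → Carrier
    0# 1#    : Carrier
    isCommutativeRing : IsCommutativeRing _≡_ _+_ _*_ -_ 0# 1#
    0≢1      : 0# ≢ 1#
    inverse  : ∀ x → x ≢ 0# → ∃ λ y → x * y ≡ 1#
    size     : ℕ
    enum     : Fin size ↔ Carrier

module FF (F : FiniteField) where
  open FiniteField F

  -- n · x  (the ℕ-action; n · 1# ranges over the prime field 𝔽_p)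
  _·_ : ℕ → Carrier → Carrier
  zero  · x = 0#
  suc n · x = x + (n · x)

  HasCharacteristic : ℕ → Set
  HasCharacteristic p = Data.Nat.Primality.Prime p × (p · 1#) ≡ 0#
    where import Data.Nat.Primality

  -- 𝔽_p-subspace of 𝔽_q (scalars of 𝔽_p are the elements m · 1#)
  record IsFpSubspace (T : Carrier → Set) : Set where
    field
      zero∈  : T 0#
      +-closed : ∀ {x y} → T x → T y → T (x + y)
      scalar-closed : ∀ (m : ℕ) {x} → T x → T ((m · 1#) * x)

  -- Polynomials over F as coefficient lists (constant term first);
  -- equality is coefficientwise, so trailing zeros are irrelevant.

  Poly : Set
  Poly = List Carrier

  coeff : Poly → ℕ → Carrier
  coeff []       _       = 0#
  coeff (a ∷ f)  zero    = a
  coeff (a ∷ f)  (suc i) = coeff f i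

  _≈P_ : Poly → Poly → Set
  f ≈P g = ∀ i → coeff f i ≡ coeff g i

  _+P_ : Poly → Poly → Poly
  []      +P g       = g
  (a ∷ f) +P []      = a ∷ f
  (a ∷ f) +P (b ∷ g) = (a + b) ∷ (f +P g)

  scaleP : Carrier → Poly → Poly
  scaleP c []      = []
  scaleP c (a ∷ f) = (c * a) ∷ scaleP c f

  _*P_ : Poly → Poly → Poly
  []      *P g = []
  (a ∷ f) *P g = scaleP a g +P (0# ∷ (f *P g))

  oneP : Poly
  oneP = 1# ∷ []

  zeroP : Poly
  zeroP = []

  -- composition f(x + t), by Horner's scheme
  shift : Carrier → Poly → Poly
  shift t []      = []
  shift t (a ∷ f) = (a ∷ []) +P ((t ∷ 1# ∷ []) *P shift t f)

  IsUnit : Poly → Set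
  IsUnit f = ∃ λ g → (f *P g) ≈P oneP

  Irreducible : Poly → Set
  Irreducible f = ¬ (f ≈P zeroP) × ¬ IsUnit f
                × (∀ g h → f ≈P (g *P h) → IsUnit g ⊎ IsUnit h)

  -- the monic polynomial of degree n  x^n + a_{n-1}x^{n-1} + … + a_0
  -- with lower coefficients v = (a_0, …, a_{n-1}); every monic polynomial of
  -- degree n arises from exactly one v.
  monic : ∀ {n} → Vec Carrier n → Poly
  monic v = toList v Data.List.++ (1# ∷ [])

  InC : (T : Carrier → Set) (n : ℕ) → Vec Carrier n → Set
  InC T n v = Irreducible (monic v) × (∀ t → T t → shift t (monic v) ≈P monic v)

  HasSize : {A : Set} → (A → Set) → ℕ → Set
  HasSize {A} P k = Σ (List A) λ xs → Unique xs × length xs ≡ k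
                                   × (∀ x → (x ∈ xs) ⇔ P x)

-- For a ≠ 0 the map f(x) ↦ aⁿ f(x/a) is a bijection on monic polynomials of degree n.
-- It preserves irreducibility, being the substitution x ↦ a⁻¹x (a ring automorphism of
-- F[x]) followed by scaling with the unit aⁿ, and it turns invariance under x ↦ x + s into
-- invariance under x ↦ x + as. So it maps C_S(n) bijectively onto C_{aS}(n). The argument
-- works for arbitrary subsets S and every n.

module Submission where

open import Defs
open import Level using (0ℓ)
open import Data.Nat using (ℕ; zero; suc; _>_)
open import Data.Product using (∃; _×_; _,_; proj₁; proj₂)
import Data.Sum as Sum
open import Data.List as List using ([]; _∷_)
open import Data.List.Properties using (length-map)
open import Data.List.Membership.Propositional using (_∈_)
open import Data.List.Membership.Propositional.Properties using (∈-map⁺; ∈-map⁻)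
open import Data.List.Relation.Unary.Unique.Propositional.Properties using (map⁺)
open import Data.Vec using (Vec) renaming ([] to []ᵥ; _∷_ to _∷ᵥ_)
open import Function.Base using (_∘_)
open import Function.Bundles using (_⇔_; _↔_; Inverse; Injection; Equivalence; mk⇔; mk↔ₛ′)
open import Function.Properties.Inverse using (↔⇒↣)
open import Relation.Binary.Bundles using (Setoid)
open import Relation.Binary.PropositionalEquality
  using (_≡_; _≢_; refl; sym; trans; cong; cong₂; subst; module ≡-Reasoning)
import Relation.Binary.Reasoning.Setoid as SetoidReasoning
open import Algebra.Bundles using (CommutativeRing)

module _ (F : FiniteField) where
  open FiniteField F
  open FF F

  HasSize-map : ∀ {A B : Set} {P : A → Set} {Q : B → Set} (φ : A ↔ B) →
                (∀ x → P x → Q (Inverse.to φ x)) → (∀ y → Q y → P (Inverse.from φ y)) →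
                ∀ {k} → HasSize P k → HasSize Q k
  HasSize-map {Q = Q} φ P⇒Q Q⇒P (xs , unique , length≡k , ∈⇔P) =
    List.map to xs , map⁺ (Injection.injective (↔⇒↣ φ)) unique ,
    trans (length-map to xs) length≡k ,
    λ y → mk⇔ (λ y∈ → let x , x∈ , y≡ = ∈-map⁻ to y∈ in
                       subst Q (sym y≡) (P⇒Q x (Equivalence.to (∈⇔P x) x∈)))
               (λ Qy → subst (_∈ List.map to xs) (Inverse.strictlyInverseˡ φ y)
                         (∈-map⁺ to (Equivalence.from (∈⇔P (from y)) (Q⇒P y Qy))))
    where open Inverse φ using (to; from)

  commutativeRing : CommutativeRing 0ℓ 0ℓ
  commutativeRing = record { isCommutativeRing = isCommutativeRing }

  open CommutativeRing commutativeRing using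
    ( +-identityˡ; +-identityʳ; *-assoc; *-comm; *-identityˡ
    ; zeroˡ; zeroʳ; distribˡ; *-commutativeSemigroup; commutativeSemiring )
  open import Algebra.Properties.CommutativeSemiring.Exp commutativeSemiring
    using (_^_; ^-distrib-*)
  open import Algebra.Properties.CommutativeSemigroup *-commutativeSemigroup
    using (x∙yz≈y∙xz; interchange)

  1^n≡1 : ∀ n → 1# ^ n ≡ 1#
  1^n≡1 zero    = refl
  1^n≡1 (suc n) = trans (*-identityˡ _) (1^n≡1 n)

  ^-inverse : ∀ {a b} → a * b ≡ 1# → ∀ n → a ^ n * b ^ n ≡ 1#
  ^-inverse {a} {b} ab≡1 n = begin
    a ^ n * b ^ n ≡⟨ ^-distrib-* a b n ⟨
    (a * b) ^ n   ≡⟨ cong (_^ n) ab≡1 ⟩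
    1# ^ n        ≡⟨ 1^n≡1 n ⟩
    1#            ∎
    where open ≡-Reasoning

  *-comm-≡1 : ∀ {a b} → a * b ≡ 1# → b * a ≡ 1#
  *-comm-≡1 {a} {b} = trans (*-comm b a)

  inverse-cancelˡ : ∀ {c d} → d * c ≡ 1# → ∀ x → d * (c * x) ≡ x
  inverse-cancelˡ {c} {d} dc≡1 x = begin
    d * (c * x) ≡⟨ *-assoc d c x ⟨
    d * c * x   ≡⟨ cong (_* x) dc≡1 ⟩
    1# * x      ≡⟨ *-identityˡ x ⟩
    x           ∎
    where open ≡-Reasoning

  -- _≈P_ wrapped in a record, so that Agda can infer both polynomials from a proof.
  infix 4 _≋_
  record _≋_ (f g : Poly) : Set where
    constructor coeffwise
    field coeff-≡ : f ≈P g
  open _≋_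

  ≋-setoid : Setoid 0ℓ 0ℓ
  ≋-setoid = record
    { Carrier = Poly
    ; _≈_ = _≋_
    ; isEquivalence = record
      { refl  = coeffwise λ i → refl
      ; sym   = λ p → coeffwise λ i → sym (coeff-≡ p i)
      ; trans = λ p q → coeffwise λ i → trans (coeff-≡ p i) (coeff-≡ q i)
      }
    }

  open Setoid ≋-setoid using () renaming (refl to ≋-refl; sym to ≋-sym; trans to ≋-trans; reflexive to ≡⇒≋)
  module ≋-Reasoning = SetoidReasoning ≋-setoid

  dilate : Carrier → Poly → Poly
  dilate b []      = []
  dilate b (a ∷ f) = a ∷ scaleP b (dilate b f)

  coeff-+P : ∀ f g i → coeff (f +P g) i ≡ coeff f i + coeff g i
  coeff-+P []      g       i       = sym (+-identityˡ _)
  coeff-+P (a ∷ f) []      i       = sym (+-identityʳ _)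
  coeff-+P (a ∷ f) (b ∷ g) zero    = refl
  coeff-+P (a ∷ f) (b ∷ g) (suc i) = coeff-+P f g i

  coeff-scaleP : ∀ c f i → coeff (scaleP c f) i ≡ c * coeff f i
  coeff-scaleP c []      i       = sym (zeroʳ c)
  coeff-scaleP c (a ∷ f) zero    = refl
  coeff-scaleP c (a ∷ f) (suc i) = coeff-scaleP c f i

  coeff-dilate : ∀ b f i → coeff (dilate b f) i ≡ b ^ i * coeff f i
  coeff-dilate b []      i       = sym (zeroʳ _)
  coeff-dilate b (a ∷ f) zero    = sym (*-identityˡ a)
  coeff-dilate b (a ∷ f) (suc i) = begin
    coeff (scaleP b (dilate b f)) i ≡⟨ coeff-scaleP b (dilate b f) i ⟩
    b * coeff (dilate b f) i        ≡⟨ cong (b *_) (coeff-dilate b f i) ⟩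
    b * (b ^ i * coeff f i)         ≡⟨ *-assoc _ _ _ ⟨
    b * b ^ i * coeff f i           ∎
    where open ≡-Reasoning

  ∷-cong : ∀ {a b f g} → a ≡ b → f ≋ g → (a ∷ f) ≋ (b ∷ g)
  ∷-cong a≡b f≋g = coeffwise λ { zero → a≡b ; (suc i) → coeff-≡ f≋g i }

  ∷-≋[] : ∀ {a f} → a ≡ 0# → f ≋ [] → (a ∷ f) ≋ []
  ∷-≋[] a≡0 f≋[] = coeffwise λ { zero → a≡0 ; (suc i) → coeff-≡ f≋[] i }

  ∷-injective : ∀ {a b f g} → (a ∷ f) ≋ (b ∷ g) → a ≡ b × f ≋ g
  ∷-injective p = coeff-≡ p zero , coeffwise (coeff-≡ p ∘ suc)

  ∷-≋[]⁻ : ∀ {a f} → (a ∷ f) ≋ [] → a ≡ 0# × f ≋ []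
  ∷-≋[]⁻ p = coeff-≡ p zero , coeffwise (coeff-≡ p ∘ suc)

  +P-cong : ∀ {f f′ g g′} → f ≋ f′ → g ≋ g′ → (f +P g) ≋ (f′ +P g′)
  +P-cong {f} {f′} {g} {g′} p q = coeffwise λ i → begin
    coeff (f +P g) i           ≡⟨ coeff-+P f g i ⟩
    coeff f i + coeff g i      ≡⟨ cong₂ _+_ (coeff-≡ p i) (coeff-≡ q i) ⟩
    coeff f′ i + coeff g′ i    ≡⟨ coeff-+P f′ g′ i ⟨
    coeff (f′ +P g′) i         ∎
    where open ≡-Reasoning

  +P-congʳ : ∀ f {g g′} → g ≋ g′ → f +P g ≋ f +P g′
  +P-congʳ f = +P-cong (≋-refl {f})

  scaleP-cong : ∀ c {f g} → f ≋ g → scaleP c f ≋ scaleP c g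
  scaleP-cong c {f} {g} p = coeffwise λ i → begin
    coeff (scaleP c f) i ≡⟨ coeff-scaleP c f i ⟩
    c * coeff f i        ≡⟨ cong (c *_) (coeff-≡ p i) ⟩
    c * coeff g i        ≡⟨ coeff-scaleP c g i ⟨
    coeff (scaleP c g) i ∎
    where open ≡-Reasoning

  dilate-cong : ∀ b {f g} → f ≋ g → dilate b f ≋ dilate b g
  dilate-cong b {f} {g} p = coeffwise λ i → begin
    coeff (dilate b f) i ≡⟨ coeff-dilate b f i ⟩
    b ^ i * coeff f i    ≡⟨ cong (b ^ i *_) (coeff-≡ p i) ⟩
    b ^ i * coeff g i    ≡⟨ coeff-dilate b g i ⟨
    coeff (dilate b g) i ∎
    where open ≡-Reasoning

  scaleP-+P : ∀ c f g → scaleP c (f +P g) ≋ scaleP c f +P scaleP c g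
  scaleP-+P c f g = coeffwise λ i → begin
    coeff (scaleP c (f +P g)) i                 ≡⟨ coeff-scaleP c (f +P g) i ⟩
    c * coeff (f +P g) i                        ≡⟨ cong (c *_) (coeff-+P f g i) ⟩
    c * (coeff f i + coeff g i)                 ≡⟨ distribˡ c _ _ ⟩
    c * coeff f i + c * coeff g i               ≡⟨ cong₂ _+_ (coeff-scaleP c f i) (coeff-scaleP c g i) ⟨
    coeff (scaleP c f) i + coeff (scaleP c g) i ≡⟨ coeff-+P (scaleP c f) (scaleP c g) i ⟨
    coeff (scaleP c f +P scaleP c g) i          ∎
    where open ≡-Reasoning

  scaleP-scaleP : ∀ c d f → scaleP c (scaleP d f) ≋ scaleP (c * d) f
  scaleP-scaleP c d f = coeffwise λ i → begin
    coeff (scaleP c (scaleP d f)) i ≡⟨ coeff-scaleP c (scaleP d f) i ⟩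
    c * coeff (scaleP d f) i        ≡⟨ cong (c *_) (coeff-scaleP d f i) ⟩
    c * (d * coeff f i)             ≡⟨ *-assoc c d _ ⟨
    c * d * coeff f i               ≡⟨ coeff-scaleP (c * d) f i ⟨
    coeff (scaleP (c * d) f) i      ∎
    where open ≡-Reasoning

  scaleP-identity : ∀ f → scaleP 1# f ≋ f
  scaleP-identity f = coeffwise λ i → trans (coeff-scaleP 1# f i) (*-identityˡ _)

  scaleP-zero : ∀ f → scaleP 0# f ≋ []
  scaleP-zero f = coeffwise λ i → trans (coeff-scaleP 0# f i) (zeroˡ _)

  dilate-+P : ∀ b f g → dilate b (f +P g) ≋ dilate b f +P dilate b g
  dilate-+P b f g = coeffwise λ i → begin
    coeff (dilate b (f +P g)) i                 ≡⟨ coeff-dilate b (f +P g) i ⟩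
    b ^ i * coeff (f +P g) i                    ≡⟨ cong (b ^ i *_) (coeff-+P f g i) ⟩
    b ^ i * (coeff f i + coeff g i)             ≡⟨ distribˡ (b ^ i) _ _ ⟩
    b ^ i * coeff f i + b ^ i * coeff g i       ≡⟨ cong₂ _+_ (coeff-dilate b f i) (coeff-dilate b g i) ⟨
    coeff (dilate b f) i + coeff (dilate b g) i ≡⟨ coeff-+P (dilate b f) (dilate b g) i ⟨
    coeff (dilate b f +P dilate b g) i          ∎
    where open ≡-Reasoning

  dilate-scaleP : ∀ b c f → dilate b (scaleP c f) ≋ scaleP c (dilate b f)
  dilate-scaleP b c f = coeffwise λ i → begin
    coeff (dilate b (scaleP c f)) i ≡⟨ coeff-dilate b (scaleP c f) i ⟩
    b ^ i * coeff (scaleP c f) i    ≡⟨ cong (b ^ i *_) (coeff-scaleP c f i) ⟩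
    b ^ i * (c * coeff f i)         ≡⟨ x∙yz≈y∙xz (b ^ i) c _ ⟩
    c * (b ^ i * coeff f i)         ≡⟨ cong (c *_) (coeff-dilate b f i) ⟨
    c * coeff (dilate b f) i        ≡⟨ coeff-scaleP c (dilate b f) i ⟨
    coeff (scaleP c (dilate b f)) i ∎
    where open ≡-Reasoning

  dilate-dilate : ∀ a b f → dilate a (dilate b f) ≋ dilate (a * b) f
  dilate-dilate a b f = coeffwise λ i → begin
    coeff (dilate a (dilate b f)) i ≡⟨ coeff-dilate a (dilate b f) i ⟩
    a ^ i * coeff (dilate b f) i    ≡⟨ cong (a ^ i *_) (coeff-dilate b f i) ⟩
    a ^ i * (b ^ i * coeff f i)     ≡⟨ *-assoc _ _ _ ⟨
    a ^ i * b ^ i * coeff f i       ≡⟨ cong (_* coeff f i) (^-distrib-* a b i) ⟨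
    (a * b) ^ i * coeff f i         ≡⟨ coeff-dilate (a * b) f i ⟨
    coeff (dilate (a * b) f) i      ∎
    where open ≡-Reasoning

  dilate-identity : ∀ f → dilate 1# f ≋ f
  dilate-identity f = coeffwise λ i → begin
    coeff (dilate 1# f) i ≡⟨ coeff-dilate 1# f i ⟩
    1# ^ i * coeff f i    ≡⟨ cong (_* coeff f i) (1^n≡1 i) ⟩
    1# * coeff f i        ≡⟨ *-identityˡ _ ⟩
    coeff f i             ∎
    where open ≡-Reasoning

  dilate-inverse : ∀ {a b} → a * b ≡ 1# → ∀ f → dilate a (dilate b f) ≋ f
  dilate-inverse {a} {b} ab≡1 f = begin
    dilate a (dilate b f) ≈⟨ dilate-dilate a b f ⟩
    dilate (a * b) f      ≡⟨ cong (λ c → dilate c f) ab≡1 ⟩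
    dilate 1# f           ≈⟨ dilate-identity f ⟩
    f                     ∎
    where open ≋-Reasoning

  scaleP-inverse : ∀ {c d} → d * c ≡ 1# → ∀ f → scaleP d (scaleP c f) ≋ f
  scaleP-inverse {c} {d} dc≡1 f = begin
    scaleP d (scaleP c f) ≈⟨ scaleP-scaleP d c f ⟩
    scaleP (d * c) f      ≡⟨ cong (λ e → scaleP e f) dc≡1 ⟩
    scaleP 1# f           ≈⟨ scaleP-identity f ⟩
    f                     ∎
    where open ≋-Reasoning

  scaleP-comm : ∀ c d f → scaleP c (scaleP d f) ≋ scaleP d (scaleP c f)
  scaleP-comm c d f = begin
    scaleP c (scaleP d f) ≈⟨ scaleP-scaleP c d f ⟩
    scaleP (c * d) f      ≡⟨ cong (λ e → scaleP e f) (*-comm c d) ⟩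
    scaleP (d * c) f      ≈⟨ scaleP-scaleP d c f ⟨
    scaleP d (scaleP c f) ∎
    where open ≋-Reasoning

  *P-zeroʳ : ∀ f {g} → g ≋ [] → f *P g ≋ []
  *P-zeroʳ []      g≋[] = ≋-refl
  *P-zeroʳ (a ∷ f) g≋[] = +P-cong (scaleP-cong a g≋[]) (∷-≋[] refl (*P-zeroʳ f g≋[]))

  *P-zeroˡ : ∀ {f} g → f ≋ [] → f *P g ≋ []
  *P-zeroˡ {[]}    g f≋[] = ≋-refl
  *P-zeroˡ {a ∷ f} g a∷f≋[] = begin
    scaleP a g +P (0# ∷ f *P g)  ≡⟨ cong (λ c → scaleP c g +P (0# ∷ f *P g)) a≡0 ⟩
    scaleP 0# g +P (0# ∷ f *P g) ≈⟨ +P-cong (scaleP-zero g) (∷-≋[] refl (*P-zeroˡ g f≋[])) ⟩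
    []                           ∎
    where
    open ≋-Reasoning
    a≡0 : a ≡ 0#
    a≡0 = proj₁ (∷-≋[]⁻ a∷f≋[])
    f≋[] : f ≋ []
    f≋[] = proj₂ (∷-≋[]⁻ a∷f≋[])

  *P-congˡ : ∀ {f f′} g → f ≋ f′ → f *P g ≋ f′ *P g
  *P-congˡ {[]}    {f′}      g p = ≋-sym (*P-zeroˡ g (≋-sym p))
  *P-congˡ {a ∷ f} {[]}      g p = *P-zeroˡ g p
  *P-congˡ {a ∷ f} {a′ ∷ f′} g p =
    +P-cong (≡⇒≋ (cong (λ c → scaleP c g) (proj₁ (∷-injective p))))
            (∷-cong refl (*P-congˡ g (proj₂ (∷-injective p))))

  *P-congʳ : ∀ f {g g′} → g ≋ g′ → f *P g ≋ f *P g′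
  *P-congʳ []      p = ≋-refl
  *P-congʳ (a ∷ f) p = +P-cong (scaleP-cong a p) (∷-cong refl (*P-congʳ f p))

  scaleP-*Pˡ : ∀ c f g → scaleP c (f *P g) ≋ scaleP c f *P g
  scaleP-*Pˡ c []      g = ≋-refl
  scaleP-*Pˡ c (a ∷ f) g = begin
    scaleP c (scaleP a g +P (0# ∷ f *P g))                ≈⟨ scaleP-+P c (scaleP a g) _ ⟩
    scaleP c (scaleP a g) +P (c * 0# ∷ scaleP c (f *P g)) ≈⟨ +P-cong (scaleP-scaleP c a g)
                                                                     (∷-cong (zeroʳ c) (scaleP-*Pˡ c f g)) ⟩
    scaleP (c * a) g +P (0# ∷ scaleP c f *P g)            ∎
    where open ≋-Reasoning

  scaleP-*Pʳ : ∀ c f g → scaleP c (f *P g) ≋ f *P scaleP c g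
  scaleP-*Pʳ c []      g = ≋-refl
  scaleP-*Pʳ c (a ∷ f) g = begin
    scaleP c (scaleP a g +P (0# ∷ f *P g))                ≈⟨ scaleP-+P c (scaleP a g) _ ⟩
    scaleP c (scaleP a g) +P (c * 0# ∷ scaleP c (f *P g)) ≈⟨ +P-cong (scaleP-comm c a g)
                                                                     (∷-cong (zeroʳ c) (scaleP-*Pʳ c f g)) ⟩
    scaleP a (scaleP c g) +P (0# ∷ f *P scaleP c g)       ∎
    where open ≋-Reasoning

  dilate-*P : ∀ b f g → dilate b (f *P g) ≋ dilate b f *P dilate b g
  dilate-*P b []      g = ≋-refl
  dilate-*P b (a ∷ f) g = begin
    dilate b (scaleP a g +P (0# ∷ f *P g))
      ≈⟨ dilate-+P b (scaleP a g) _ ⟩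
    dilate b (scaleP a g) +P (0# ∷ scaleP b (dilate b (f *P g)))
      ≈⟨ +P-cong (dilate-scaleP b a g) (∷-cong refl (scaleP-cong b (dilate-*P b f g))) ⟩
    scaleP a (dilate b g) +P (0# ∷ scaleP b (dilate b f *P dilate b g))
      ≈⟨ +P-congʳ (scaleP a (dilate b g)) (∷-cong refl (scaleP-*Pˡ b (dilate b f) (dilate b g))) ⟩
    scaleP a (dilate b g) +P (0# ∷ scaleP b (dilate b f) *P dilate b g)
      ∎
    where open ≋-Reasoning

  infix 25 X+_
  X+_ : Carrier → Poly
  X+ t = t ∷ 1# ∷ []

  shift-≋[] : ∀ t {f} → f ≋ [] → shift t f ≋ []
  shift-≋[] t {[]}    f≋[]   = ≋-refl
  shift-≋[] t {a ∷ f} a∷f≋[] =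
    +P-cong (∷-≋[] (proj₁ (∷-≋[]⁻ a∷f≋[])) ≋-refl)
            (*P-zeroʳ (X+ t) (shift-≋[] t (proj₂ (∷-≋[]⁻ a∷f≋[]))))

  shift-cong : ∀ t {f f′} → f ≋ f′ → shift t f ≋ shift t f′
  shift-cong t {[]}    {f′}      p = ≋-sym (shift-≋[] t (≋-sym p))
  shift-cong t {a ∷ f} {[]}      p = shift-≋[] t p
  shift-cong t {a ∷ f} {a′ ∷ f′} p =
    +P-cong (∷-cong (proj₁ (∷-injective p)) ≋-refl)
            (*P-congʳ (X+ t) (shift-cong t (proj₂ (∷-injective p))))

  shift-scaleP : ∀ t c f → shift t (scaleP c f) ≋ scaleP c (shift t f)
  shift-scaleP t c []      = ≋-refl
  shift-scaleP t c (a ∷ f) = begin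
    (c * a ∷ []) +P (X+ t *P shift t (scaleP c f)) ≈⟨ +P-congʳ (c * a ∷ []) (*P-congʳ (X+ t) (shift-scaleP t c f)) ⟩
    (c * a ∷ []) +P (X+ t *P scaleP c (shift t f)) ≈⟨ +P-congʳ (c * a ∷ []) (scaleP-*Pʳ c (X+ t) (shift t f)) ⟨
    (c * a ∷ []) +P scaleP c (X+ t *P shift t f)   ≈⟨ scaleP-+P c (a ∷ []) (X+ t *P shift t f) ⟨
    scaleP c ((a ∷ []) +P (X+ t *P shift t f))     ∎
    where open ≋-Reasoning

  -- The middle step uses that dilate b (X+ (b * t)) and scaleP b (X+ t) are the same list.
  shift-dilate : ∀ t b f → shift t (dilate b f) ≋ dilate b (shift (b * t) f)
  shift-dilate t b []      = ≋-refl
  shift-dilate t b (a ∷ f) = begin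
    (a ∷ []) +P (X+ t *P shift t (scaleP b (dilate b f)))
      ≈⟨ +P-congʳ (a ∷ []) (*P-congʳ (X+ t) (shift-scaleP t b (dilate b f))) ⟩
    (a ∷ []) +P (X+ t *P scaleP b (shift t (dilate b f)))
      ≈⟨ +P-congʳ (a ∷ []) (*P-congʳ (X+ t) (scaleP-cong b (shift-dilate t b f))) ⟩
    (a ∷ []) +P (X+ t *P scaleP b (dilate b (shift (b * t) f)))
      ≈⟨ +P-congʳ (a ∷ []) (scaleP-*Pʳ b (X+ t) (dilate b (shift (b * t) f))) ⟨
    (a ∷ []) +P scaleP b (X+ t *P dilate b (shift (b * t) f))
      ≈⟨ +P-congʳ (a ∷ []) (scaleP-*Pˡ b (X+ t) (dilate b (shift (b * t) f))) ⟩
    (a ∷ []) +P (dilate b (X+ (b * t)) *P dilate b (shift (b * t) f))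
      ≈⟨ +P-congʳ (a ∷ []) (dilate-*P b (X+ (b * t)) (shift (b * t) f)) ⟨
    (a ∷ []) +P dilate b (X+ (b * t) *P shift (b * t) f)
      ≈⟨ dilate-+P b (a ∷ []) (X+ (b * t) *P shift (b * t) f) ⟨
    dilate b ((a ∷ []) +P (X+ (b * t) *P shift (b * t) f))
      ∎
    where open ≋-Reasoning

  IsUnit-resp-≋ : ∀ {f g} → f ≋ g → IsUnit f → IsUnit g
  IsUnit-resp-≋ {f} {g} f≋g (h , fh≈1) = h , coeff-≡ (begin
    g *P h ≈⟨ *P-congˡ h f≋g ⟨
    f *P h ≈⟨ coeffwise fh≈1 ⟩
    oneP   ∎)
    where open ≋-Reasoning

  Irreducible-resp-≋ : ∀ {f g} → f ≋ g → Irreducible f → Irreducible g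
  Irreducible-resp-≋ {f} {g} f≋g (f≉0 , ¬unit , factor) =
    (λ g≈0 → f≉0 (coeff-≡ (≋-trans f≋g (coeffwise {g} {[]} g≈0)))) ,
    ¬unit ∘ IsUnit-resp-≋ (≋-sym f≋g) ,
    λ h k g≈hk → factor h k (coeff-≡ (≋-trans f≋g (coeffwise {g} {h *P k} g≈hk)))

  IsUnit-scaleP : ∀ c f → IsUnit (scaleP c f) → IsUnit f
  IsUnit-scaleP c f (g , cfg≈1) = scaleP c g , coeff-≡ (begin
    f *P scaleP c g   ≈⟨ scaleP-*Pʳ c f g ⟨
    scaleP c (f *P g) ≈⟨ scaleP-*Pˡ c f g ⟩
    scaleP c f *P g   ≈⟨ coeffwise cfg≈1 ⟩
    oneP              ∎)
    where open ≋-Reasoning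

  IsUnit-dilate : ∀ {a b} → a * b ≡ 1# → ∀ f → IsUnit (dilate b f) → IsUnit f
  IsUnit-dilate {a} {b} ab≡1 f (g , bfg≈1) = dilate a g , coeff-≡ (begin
    f *P dilate a g                     ≈⟨ *P-congˡ (dilate a g) (dilate-inverse ab≡1 f) ⟨
    dilate a (dilate b f) *P dilate a g ≈⟨ dilate-*P a (dilate b f) g ⟨
    dilate a (dilate b f *P g)          ≈⟨ dilate-cong a (coeffwise bfg≈1) ⟩
    dilate a oneP                       ≡⟨⟩
    oneP                                ∎)
    where open ≋-Reasoning

  Irreducible-scaleP : ∀ {c d} → d * c ≡ 1# → ∀ f → Irreducible f → Irreducible (scaleP c f)
  Irreducible-scaleP {c} {d} dc≡1 f (f≉0 , ¬unit , factor) =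
    (λ cf≈0 → f≉0 (coeff-≡ (unscale (scaleP-cong d (coeffwise {scaleP c f} {[]} cf≈0))))) ,
    ¬unit ∘ IsUnit-scaleP c f ,
    λ g h cf≈gh → Sum.map₁ (IsUnit-scaleP d g) (factor (scaleP d g) h (coeff-≡
      (unscale (≋-trans (scaleP-cong d (coeffwise {scaleP c f} {g *P h} cf≈gh)) (scaleP-*Pˡ d g h)))))
    where
    unscale : ∀ {g} → scaleP d (scaleP c f) ≋ g → f ≋ g
    unscale = ≋-trans (≋-sym (scaleP-inverse dc≡1 f))

  Irreducible-dilate : ∀ {a b} → a * b ≡ 1# → ∀ f → Irreducible f → Irreducible (dilate b f)
  Irreducible-dilate {a} {b} ab≡1 f (f≉0 , ¬unit , factor) =
    (λ bf≈0 → f≉0 (coeff-≡ (undilate (dilate-cong a (coeffwise {dilate b f} {[]} bf≈0))))) ,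
    ¬unit ∘ IsUnit-dilate ab≡1 f ,
    λ g h bf≈gh → Sum.map (IsUnit-dilate ba≡1 g) (IsUnit-dilate ba≡1 h)
      (factor (dilate a g) (dilate a h) (coeff-≡
        (undilate (≋-trans (dilate-cong a (coeffwise {dilate b f} {g *P h} bf≈gh)) (dilate-*P a g h)))))
    where
    ba≡1 : b * a ≡ 1#
    ba≡1 = *-comm-≡1 ab≡1
    undilate : ∀ {g} → dilate a (dilate b f) ≋ g → f ≋ g
    undilate = ≋-trans (≋-sym (dilate-inverse ab≡1 f))

  rescale : Carrier → Carrier → ∀ {n} → Vec Carrier n → Vec Carrier n
  rescale b c []ᵥ       = []ᵥ
  rescale b c (x ∷ᵥ xs) = c * x ∷ᵥ rescale b (c * b) xs

  monic-rescale : ∀ b c {n} (v : Vec Carrier n) → c * b ^ n ≡ 1# →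
                  monic (rescale b c v) ≋ scaleP c (dilate b (monic v))
  monic-rescale b c []ᵥ       c≡1 = ∷-cong (sym c≡1) ≋-refl
  monic-rescale b c (x ∷ᵥ xs) cbbⁿ≡1 = ∷-cong refl (begin
    monic (rescale b (c * b) xs)              ≈⟨ monic-rescale b (c * b) xs (trans (*-assoc c b _) cbbⁿ≡1) ⟩
    scaleP (c * b) (dilate b (monic xs))      ≈⟨ scaleP-scaleP c b (dilate b (monic xs)) ⟨
    scaleP c (scaleP b (dilate b (monic xs))) ∎)
    where open ≋-Reasoning

  rescale-inverse : ∀ {a b c d} → a * b ≡ 1# → d * c ≡ 1# →
                    ∀ {n} (v : Vec Carrier n) → rescale a d (rescale b c v) ≡ v
  rescale-inverse ab≡1 dc≡1 []ᵥ       = refl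
  rescale-inverse {a} {b} {c} {d} ab≡1 dc≡1 (x ∷ᵥ xs) =
    cong₂ _∷ᵥ_ (inverse-cancelˡ dc≡1 x) (rescale-inverse ab≡1 dacb≡1 xs)
    where
    dacb≡1 : d * a * (c * b) ≡ 1#
    dacb≡1 = begin
      d * a * (c * b) ≡⟨ interchange d a c b ⟩
      d * c * (a * b) ≡⟨ cong₂ _*_ dc≡1 ab≡1 ⟩
      1# * 1#         ≡⟨ *-identityˡ 1# ⟩
      1#              ∎
      where open ≡-Reasoning

  rescale-↔ : ∀ {a b} → a * b ≡ 1# → ∀ n → Vec Carrier n ↔ Vec Carrier n
  rescale-↔ {a} {b} ab≡1 n = mk↔ₛ′ (rescale b (a ^ n)) (rescale a (b ^ n))
    (rescale-inverse (*-comm-≡1 ab≡1) (^-inverse ab≡1 n))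
    (rescale-inverse ab≡1 (^-inverse (*-comm-≡1 ab≡1) n))

  InC-rescale : ∀ {a b} → a * b ≡ 1# → ∀ {S S′ : Carrier → Set} → (∀ t → S′ t → S (b * t)) →
                ∀ {n} (v : Vec Carrier n) → InC S n v → InC S′ n (rescale b (a ^ n) v)
  InC-rescale {a} {b} ab≡1 {S} {S′} bS′⊆S {n} v (f-irreducible , f-invariant) =
    Irreducible-resp-≋ (≋-sym g≋cf[bx])
      (Irreducible-scaleP (^-inverse (*-comm-≡1 ab≡1) n) (dilate b f)
        (Irreducible-dilate ab≡1 f f-irreducible)) ,
    λ t S′t → coeff-≡ (begin
      shift t g                             ≈⟨ shift-cong t g≋cf[bx] ⟩
      shift t (scaleP c (dilate b f))       ≈⟨ shift-scaleP t c (dilate b f) ⟩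
      scaleP c (shift t (dilate b f))       ≈⟨ scaleP-cong c (shift-dilate t b f) ⟩
      scaleP c (dilate b (shift (b * t) f)) ≈⟨ scaleP-cong c (dilate-cong b (invariant (b * t) (bS′⊆S t S′t))) ⟩
      scaleP c (dilate b f)                 ≈⟨ g≋cf[bx] ⟨
      g                                     ∎)
    where
    open ≋-Reasoning
    c : Carrier
    c = a ^ n
    f g : Poly
    f = monic v
    g = monic (rescale b c v)
    g≋cf[bx] : g ≋ scaleP c (dilate b f)
    g≋cf[bx] = monic-rescale b c v (^-inverse ab≡1 n)
    invariant : ∀ s → S s → shift s f ≋ f
    invariant s Ss = coeffwise (f-invariant s Ss)

  HasSize-InC-scale : ∀ {a b} → a * b ≡ 1# → ∀ {S S′ : Carrier → Set} →
                      (∀ t → S′ t → S (b * t)) → (∀ s → S s → S′ (a * s)) →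
                      ∀ n {k} → HasSize (InC S n) k → HasSize (InC S′ n) k
  HasSize-InC-scale ab≡1 bS′⊆S aS⊆S′ n =
    HasSize-map (rescale-↔ ab≡1 n) (InC-rescale ab≡1 bS′⊆S) (InC-rescale (*-comm-≡1 ab≡1) aS⊆S′)

lemma2p4 : (F : FiniteField) (p : ℕ) → FF.HasCharacteristic F p
         → (S S' : FiniteField.Carrier F → Set)
         → FF.IsFpSubspace F S → FF.IsFpSubspace F S'
         → (a : FiniteField.Carrier F) → a ≢ FiniteField.0# F
         → (∀ x → S' x ⇔ (∃ λ s → S s × x ≡ FiniteField._*_ F a s))
         → (n : ℕ) → n > 0
         → (k : ℕ) → FF.HasSize F (FF.InC F S n) k ⇔ FF.HasSize F (FF.InC F S' n) k
lemma2p4 F _ _ S S' _ _ a a≢0 S'≡aS n _ k =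
  mk⇔ (HasSize-InC-scale F ab≡1 bS'⊆S aS⊆S' n) (HasSize-InC-scale F (*-comm-≡1 F ab≡1) aS⊆S' bS'⊆S n)
  where
  open FiniteField F
  b : Carrier
  b = proj₁ (inverse a a≢0)
  ab≡1 : a * b ≡ 1#
  ab≡1 = proj₂ (inverse a a≢0)
  aS⊆S' : ∀ s → S s → S' (a * s)
  aS⊆S' s Ss = Equivalence.from (S'≡aS (a * s)) (s , Ss , refl)
  bS'⊆S : ∀ t → S' t → S (b * t)
  bS'⊆S t S't with Equivalence.to (S'≡aS t) S't
  ... | s , Ss , refl = subst S (sym (inverse-cancelˡ F (*-comm-≡1 F ab≡1) s)) Ss
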